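{- Let $f^{\uparrow}_{\mathrm{UFR}}(n,k)$ be the number of weakly increasing unit Fubini rankings with $n$ competitors having exactly $k$ lucky cars (with $f^{\uparrow}_{\mathrm{UFR}}(0,0)=1$ and $f^{\uparrow}_{\mathrm{UFR}}(0,k)=0$ for $k\ne0$). Then \[\sum_{n\ge0}\sum_{k\ge0}f^{\uparrow}_{\mathrm{UFR}}(n,k)\,q^k\frac{x^n}{n!}=\frac{\lambda_1e^{\lambda_1x}-\lambda_2e^{\lambda_2x}}{\lambda_1-\lambda_2},\] where $\lambda_1=\frac{q+\sqrt{q^2+4q}}{2}$ and $\lambda_2=\frac{q-\sqrt{q^2+4q}}{2}$.
   Context: A weakly increasing unit Fubini ranking with $n$ competitors is a tuple $\alpha=(a_1,\ldots,a_n)\in\{1,\ldots,n\}^n$ with $a_1\le\cdots\le a_n$, $a_i=1+|\{j:a_j<a_i\}|$ for every $i$, and each value appearing at most twice. Lucky cars: cars $1,\ldots,n$ enter in order a one-way street with spots $1,\ldots,n$; car $i$ parks at spot $a_i$ if free, else at the first free spot after $a_i$; car $i$ is lucky if it parks at spot $a_i$. -}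

module Defs where

open import Data.Nat using (ℕ; zero; suc; _+_; _<ᵇ_; _≡ᵇ_; _≤ᵇ_)
open import Data.Bool using (Bool; true; false; _∧_; if_then_else_)
open import Data.List using (List; []; _∷_; length; map; concatMap; filterᵇ)
open import Data.Bool.ListAction using (all; any)
open import Algebra.Bundles using (CommutativeRing; Semiring; RawSemiring)
import Algebra.Definitions.RawSemiring as RS
open import Data.Product using (_,_) renaming (_×_ to _⊗_)

tuples : ℕ → ℕ → List (List ℕ)
tuples m zero = [] ∷ []
tuples m (suc len) = concatMap (λ v → map (v ∷_) (tuples m len)) (Data.List.map suc (Data.List.upTo m))

countLess : ℕ → List ℕ → ℕ
countLess v xs = length (filterᵇ (λ a → a <ᵇ v) xs)

countEq : ℕ → List ℕ → ℕ
countEq v xs = length (filterᵇ (λ a → a ≡ᵇ v) xs)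

weaklyIncreasing : List ℕ → Bool
weaklyIncreasing [] = true
weaklyIncreasing (a ∷ []) = true
weaklyIncreasing (a ∷ b ∷ xs) = (a ≤ᵇ b) ∧ weaklyIncreasing (b ∷ xs)

isWIUFR : List ℕ → Bool
isWIUFR α = weaklyIncreasing α
          ∧ all (λ a → suc (countLess a α) ≡ᵇ a) α
          ∧ all (λ a → countEq a α ≤ᵇ 2) α

firstFree : ℕ → List ℕ → ℕ → ℕ → Bool ⊗ ℕ
firstFree n occ a zero = false , a
firstFree n occ a (suc fuel) =
  if n <ᵇ a then (false , a)
  else (if any (λ o → o ≡ᵇ a) occ then firstFree n occ (suc a) fuel else (true , a))

-- cars park in order; returns the number of lucky cars
-- (a car with no free spot at or after its preference leaves and is not lucky)
luckyGo : ℕ → List ℕ → List ℕ → ℕ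
luckyGo n occ [] = 0
luckyGo n occ (a ∷ as) with firstFree n occ a n
... | (false , _) = luckyGo n occ as
... | (true , p) = (if p ≡ᵇ a then 1 else 0) + luckyGo n (p ∷ occ) as

lucky : ℕ → List ℕ → ℕ
lucky n α = luckyGo n [] α

fUFR : ℕ → ℕ → ℕ
fUFR n k = length (filterᵇ (λ α → isWIUFR α ∧ (lucky n α ≡ᵇ k)) (tuples n n))

rawSR : ∀ {c ℓ} → CommutativeRing c ℓ → RawSemiring c ℓ
rawSR R = Semiring.rawSemiring (CommutativeRing.semiring R)

module _ {c ℓ} (R : CommutativeRing c ℓ) where
  open CommutativeRing R using (Carrier) renaming (_+_ to _+ᴿ_)
  open RS (rawSR R) using (_×_; _^_)

  polySum : ℕ → Carrier → ℕ → Carrier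
  polySum n q zero = fUFR n 0 × (q ^ 0)
  polySum n q (suc m) = polySum n q m +ᴿ fUFR n (suc m) × (q ^ suc m)

  -- coefficient of x^n/n! on the left-hand side: Σ_{k≥0} f(n,k) q^k
  -- (f(n,k)=0 for k>n, since there are at most n lucky cars)
  lhsCoeff : Carrier → ℕ → Carrier
  lhsCoeff q n = polySum n q n

{-# OPTIONS --safe #-}
module Submission where

open import Defs
open import Data.Nat using (ℕ; suc)
open import Algebra.Bundles using (CommutativeRing)
import Algebra.Definitions.RawSemiring as RS
import Relation.Binary.Reasoning.Setoid as SetoidReasoning

-- A weakly increasing unit Fubini ranking is exactly a concatenation of blocks (i) and
-- (i, i), where i is one more than the number of entries before the block. When such a
-- ranking is parked, the first car of each block is lucky and the second car of a block
-- (i, i) parks at i + 1, so the lucky cars count the blocks. Hence f(n, k) is the number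
-- of compositions of n into k parts equal to 1 or 2, and L n = Σₖ f(n, k) qᵏ satisfies
-- L 0 = 1, L 1 = q and L (n + 2) = q L (n + 1) + q L n. Every root x of x² = q x + q
-- then has x^(n+1) = L n x + q L (n - 1); subtracting this identity for the two roots
-- λ₁,₂ = (q ± s)/2 gives (λ₁ - λ₂) L n = λ₁^(n+1) - λ₂^(n+1), which is the coefficient of
-- xⁿ/n! in the exponential generating function identity.

module Compositions where

  open import Data.Bool.Base using (Bool; true; false; T; _∧_; _∨_)
  open import Data.Bool.ListAction using (any)
  open import Data.Bool.Properties using (T-∧; T-∨; ∧-zeroʳ; ∨-identityʳ)
  open import Data.List.Base using (List; []; _∷_; length; map; filterᵇ; concatMap; upTo; applyUpTo; _++_)
  open import Data.List.Properties using (filter-++; length-++; map-upTo)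
  open import Data.List.Relation.Unary.All as All using (All; []; _∷_)
  open import Data.List.Relation.Unary.All.Properties using (all⁺; all⁻; concat⁺; map⁺; gmap⁺)
  open import Data.List.Relation.Unary.Linked as Linked using (Linked; []; [-]; _∷_)
  open import Data.List.Relation.Unary.Linked.Properties using (Linked⇒All)
  open import Data.Nat.Base using (zero; _+_; _*_; _≤_; _<_; _≡ᵇ_; z≤n; s≤s; s≤s⁻¹)
  open import Data.Nat.Properties
  open import Data.Product.Base using (_,_)
  open import Data.Sum.Base using (inj₁; inj₂)
  open import Function.Base using (_∘_)
  open import Function.Bundles using (_⇔_; mk⇔; Equivalence)
  open import Relation.Nullary.Decidable using (T?; yes; no; dec-true; dec-false)
  open import Relation.Nullary.Negation using (contradiction)
  open import Relation.Binary.PropositionalEquality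
  open ≡-Reasoning

  private
    variable
      A B : Set

  countᵇ : (A → Bool) → List A → ℕ
  countᵇ p xs = length (filterᵇ p xs)

  countᵇ-++ : ∀ (p : A → Bool) xs ys → countᵇ p (xs ++ ys) ≡ countᵇ p xs + countᵇ p ys
  countᵇ-++ p xs ys = trans (cong length (filter-++ (T? ∘ p) xs ys)) (length-++ (filterᵇ p xs))

  countᵇ-map : ∀ (p : A → Bool) (f : B → A) xs → countᵇ p (map f xs) ≡ countᵇ (p ∘ f) xs
  countᵇ-map p f [] = refl
  countᵇ-map p f (x ∷ xs) with p (f x)
  ... | true  = cong suc (countᵇ-map p f xs)
  ... | false = countᵇ-map p f xs

  countᵇ-congᴬ : ∀ {p q : A → Bool} {xs} → All (λ x → p x ≡ q x) xs → countᵇ p xs ≡ countᵇ q xs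
  countᵇ-congᴬ [] = refl
  countᵇ-congᴬ {p = p} {q} {x ∷ _} (px≡qx ∷ eqs) with p x | q x | px≡qx
  ... | true  | true  | refl = cong suc (countᵇ-congᴬ eqs)
  ... | false | false | refl = countᵇ-congᴬ eqs

  countᵇ-cong : ∀ {p q : A → Bool} → (∀ x → p x ≡ q x) → ∀ xs → countᵇ p xs ≡ countᵇ q xs
  countᵇ-cong p≗q xs = countᵇ-congᴬ (All.universal p≗q xs)

  countᵇ-none : ∀ {p : A → Bool} {xs} → All (λ x → p x ≡ false) xs → countᵇ p xs ≡ 0
  countᵇ-none [] = refl
  countᵇ-none {p = p} {x ∷ _} (px≡false ∷ rest) with p x | px≡false
  ... | false | refl = countᵇ-none rest

  countᵇ-∨ : ∀ (p q : A → Bool) → (∀ x → p x ∧ q x ≡ false) → ∀ xs →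
             countᵇ (λ x → p x ∨ q x) xs ≡ countᵇ p xs + countᵇ q xs
  countᵇ-∨ p q disjoint [] = refl
  countᵇ-∨ p q disjoint (x ∷ xs) with p x | q x | disjoint x
  ... | true  | false | _ = cong suc (countᵇ-∨ p q disjoint xs)
  ... | false | true  | _ = trans (cong suc (countᵇ-∨ p q disjoint xs)) (sym (+-suc _ _))
  ... | false | false | _ = countᵇ-∨ p q disjoint xs

  countᵇ-concatMap-∷ : ∀ {P Q : List A → Bool} {e : A → Bool} (rs : List (List A)) →
                       (∀ v r → P (v ∷ r) ≡ e v ∧ Q r) → ∀ vs →
                       countᵇ P (concatMap (λ v → map (v ∷_) rs) vs) ≡ countᵇ e vs * countᵇ Q rs
  countᵇ-concatMap-∷ rs shape [] = refl
  countᵇ-concatMap-∷ {P = P} {Q} {e} rs shape (v ∷ vs) = begin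
    countᵇ P (map (v ∷_) rs ++ concatMap (λ v → map (v ∷_) rs) vs)
      ≡⟨ countᵇ-++ P (map (v ∷_) rs) _ ⟩
    countᵇ P (map (v ∷_) rs) + countᵇ P (concatMap (λ v → map (v ∷_) rs) vs)
      ≡⟨ cong₂ _+_ (trans (countᵇ-map P (v ∷_) rs) (countᵇ-cong (shape v) rs))
                   (countᵇ-concatMap-∷ rs shape vs) ⟩
    countᵇ (λ r → e v ∧ Q r) rs + countᵇ e vs * countᵇ Q rs
      ≡⟨ head-factor ⟩
    countᵇ e (v ∷ vs) * countᵇ Q rs ∎
    where
    head-factor : countᵇ (λ r → e v ∧ Q r) rs + countᵇ e vs * countᵇ Q rs
                ≡ countᵇ e (v ∷ vs) * countᵇ Q rs
    head-factor with e v
    ... | true  = refl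
    ... | false = cong (_+ countᵇ e vs * countᵇ Q rs) (countᵇ-none (All.universal (λ _ → refl) rs))

  countᵇ-≡ᵇ-upTo : ∀ {i m} → i < m → countᵇ (_≡ᵇ i) (upTo m) ≡ 1
  countᵇ-≡ᵇ-upTo {zero} {suc m} _ = cong suc (begin
    countᵇ (_≡ᵇ 0) (applyUpTo suc m)  ≡⟨ cong (countᵇ (_≡ᵇ 0)) (map-upTo suc m) ⟨
    countᵇ (_≡ᵇ 0) (map suc (upTo m)) ≡⟨ countᵇ-map (_≡ᵇ 0) suc (upTo m) ⟩
    countᵇ (λ _ → false) (upTo m)     ≡⟨ countᵇ-none (All.universal (λ _ → refl) (upTo m)) ⟩
    0                                 ∎)
  countᵇ-≡ᵇ-upTo {suc i} {suc m} (s≤s i<m) = begin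
    countᵇ (_≡ᵇ suc i) (applyUpTo suc m)  ≡⟨ cong (countᵇ (_≡ᵇ suc i)) (map-upTo suc m) ⟨
    countᵇ (_≡ᵇ suc i) (map suc (upTo m)) ≡⟨ countᵇ-map (_≡ᵇ suc i) suc (upTo m) ⟩
    countᵇ (_≡ᵇ i) (upTo m)               ≡⟨ countᵇ-≡ᵇ-upTo i<m ⟩
    1                                     ∎

  ≡ᵇ-refl : ∀ n → (n ≡ᵇ n) ≡ true
  ≡ᵇ-refl n = dec-true (n ≟ n) refl

  ≡ᵇ-≢ : ∀ {m n} → m ≢ n → (m ≡ᵇ n) ≡ false
  ≡ᵇ-≢ {m} {n} = dec-false (m ≟ n)

  Linked-≤-∷⁺ : ∀ {x γ} → All (x ≤_) γ → Linked _≤_ γ → Linked _≤_ (x ∷ γ)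
  Linked-≤-∷⁺ []        [] = [-]
  Linked-≤-∷⁺ (x≤y ∷ _) l  = x≤y ∷ l

  Linked-≤-∷⁻ : ∀ {x γ} → Linked _≤_ (x ∷ γ) → All (x ≤_) γ
  Linked-≤-∷⁻ [-]       = []
  Linked-≤-∷⁻ (x≤y ∷ l) = Linked⇒All ≤-trans x≤y l

  All-⇔ : ∀ {P Q R : A → Set} {γ} → (∀ {a} → R a → P a ⇔ Q a) → All R γ → All P γ ⇔ All Q γ
  All-⇔ f rs = mk⇔ (λ ps → All.zipWith (λ (r , p) → Equivalence.to   (f r) p) (rs , ps))
                   (λ qs → All.zipWith (λ (r , q) → Equivalence.from (f r) q) (rs , qs))

  countLess-∷-< : ∀ {x a} δ → x < a → countLess a (x ∷ δ) ≡ suc (countLess a δ)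
  countLess-∷-< {x} {a} δ x<a rewrite dec-true (x <? a) x<a = refl

  countLess-minimum : ∀ {x δ} → All (x ≤_) δ → countLess x δ ≡ 0
  countLess-minimum = countᵇ-none ∘ All.map (λ x≤a → dec-false (_ <? _) (≤⇒≯ x≤a))

  countEq-∷-≡ : ∀ a δ → countEq a (a ∷ δ) ≡ suc (countEq a δ)
  countEq-∷-≡ a δ rewrite ≡ᵇ-refl a = refl

  countEq-∷-≢ : ∀ {x a} δ → x ≢ a → countEq a (x ∷ δ) ≡ countEq a δ
  countEq-∷-≢ δ x≢a rewrite ≡ᵇ-≢ x≢a = refl

  countEq-above : ∀ {x δ} → All (x <_) δ → countEq x δ ≡ 0
  countEq-above = countᵇ-none ∘ All.map (λ x<a → ≡ᵇ-≢ (≢-sym (<⇒≢ x<a)))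

  countEq≡0-above : ∀ {x δ} → All (x ≤_) δ → countEq x δ ≡ 0 → All (x <_) δ
  countEq≡0-above             []          _ = []
  countEq≡0-above {x} {a ∷ δ} (x≤a ∷ x≤δ) c with a ≟ x
  ... | yes refl = contradiction (trans (sym (countEq-∷-≡ a δ)) c) 1+n≢0
  ... | no  a≢x  =
    ≤∧≢⇒< x≤a (≢-sym a≢x) ∷ countEq≡0-above x≤δ (trans (sym (countEq-∷-≢ δ a≢x)) c)

  -- off counts the entries preceding α; a block placed after j entries consists of the value j + 1.
  data Blocks (off : ℕ) : List ℕ → Set where
    []     : Blocks off []
    single : ∀ {r} → Blocks (suc off) r → Blocks off (suc off ∷ r)
    double : ∀ {r} → Blocks (2 + off) r → Blocks off (suc off ∷ suc off ∷ r)

  blockCount : ∀ {off α} → Blocks off α → ℕ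
  blockCount []         = 0
  blockCount (single b) = suc (blockCount b)
  blockCount (double b) = suc (blockCount b)

  Blocks-bound : ∀ {off α} → Blocks off α → All (off <_) α
  Blocks-bound []         = []
  Blocks-bound (single b) = ≤-refl ∷ All.map (<-trans (n<1+n _)) (Blocks-bound b)
  Blocks-bound (double b) =
    ≤-refl ∷ ≤-refl ∷ All.map (<-trans (n<1+n _) ∘ <-trans (n<1+n _)) (Blocks-bound b)

  -- The conditions of isWIUFR for a suffix γ that follows off smaller entries.
  record WIUFRFrom (off : ℕ) (γ : List ℕ) : Set where
    field
      sorted : Linked _≤_ γ
      ranked : All (λ a → off + suc (countLess a γ) ≡ a) γ
      unit   : All (λ a → countEq a γ ≤ 2) γ
  open WIUFRFrom

  weaklyIncreasing⇔Linked : ∀ {xs} → T (weaklyIncreasing xs) ⇔ Linked _≤_ xs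
  weaklyIncreasing⇔Linked = mk⇔ to from
    where
    to : ∀ {xs} → T (weaklyIncreasing xs) → Linked _≤_ xs
    to {[]}        _ = []
    to {_ ∷ []}    _ = [-]
    to {x ∷ y ∷ _} t = let x≤y , rest = Equivalence.to T-∧ t in ≤ᵇ⇒≤ x y x≤y ∷ to rest
    from : ∀ {xs} → Linked _≤_ xs → T (weaklyIncreasing xs)
    from []        = _
    from [-]       = _
    from (x≤y ∷ l) = Equivalence.from T-∧ (≤⇒≤ᵇ x≤y , from l)

  isWIUFR⇔WIUFRFrom : ∀ {α} → T (isWIUFR α) ⇔ WIUFRFrom 0 α
  isWIUFR⇔WIUFRFrom {α} = mk⇔ to from
    where
    to : T (isWIUFR α) → WIUFRFrom 0 α
    to t with w , t′ ← Equivalence.to T-∧ t with r , u ← Equivalence.to T-∧ t′ = record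
      { sorted = Equivalence.to weaklyIncreasing⇔Linked w
      ; ranked = All.map (≡ᵇ⇒≡ _ _) (all⁺ _ α r)
      ; unit   = All.map (≤ᵇ⇒≤ _ 2) (all⁺ _ α u)
      }
    from : WIUFRFrom 0 α → T (isWIUFR α)
    from w = Equivalence.from T-∧
      ( Equivalence.from weaklyIncreasing⇔Linked (sorted w)
      , Equivalence.from T-∧ ( all⁻ _ (All.map (≡⇒≡ᵇ _ _) (ranked w))
                             , all⁻ _ (All.map ≤⇒≤ᵇ (unit w))))

  shift-ranked : ∀ {off x δ γ} → All (x <_) γ →
    All (λ a → off + suc (countLess a (x ∷ δ)) ≡ a) γ ⇔
    All (λ a → suc off + suc (countLess a δ) ≡ a) γ
  shift-ranked {off} {δ = δ} = All-⇔ λ x<a →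
    let shift = trans (cong (λ c → off + suc c) (countLess-∷-< δ x<a)) (+-suc off _)
    in mk⇔ (trans (sym shift)) (trans shift)

  shift-unit : ∀ {x δ γ} → All (x <_) γ →
    All (λ a → countEq a (x ∷ δ) ≤ 2) γ ⇔ All (λ a → countEq a δ ≤ 2) γ
  shift-unit {δ = δ} = All-⇔ λ x<a →
    let shift = countEq-∷-≢ δ (<⇒≢ x<a)
    in mk⇔ (subst (_≤ 2) shift) (subst (_≤ 2) (sym shift))

  rank-minimum : ∀ {off x δ} → All (x ≤_) δ → off + suc (countLess x δ) ≡ suc off
  rank-minimum {off} x≤δ = trans (cong (λ c → off + suc c) (countLess-minimum x≤δ)) (+-comm off 1)

  module _ {off : ℕ} {γ : List ℕ} where

    peel-single : All (suc off <_) γ → WIUFRFrom off (suc off ∷ γ) ⇔ WIUFRFrom (suc off) γ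
    peel-single x<γ = mk⇔ to from
      where
      x≤γ = All.map <⇒≤ x<γ
      to : WIUFRFrom off (suc off ∷ γ) → WIUFRFrom (suc off) γ
      to w = record
        { sorted = Linked.tail (sorted w)
        ; ranked = Equivalence.to (shift-ranked x<γ) (All.tail (ranked w))
        ; unit   = Equivalence.to (shift-unit x<γ) (All.tail (unit w))
        }
      single-count : countEq (suc off) (suc off ∷ γ) ≡ 1
      single-count = trans (countEq-∷-≡ (suc off) γ) (cong suc (countEq-above x<γ))
      from : WIUFRFrom (suc off) γ → WIUFRFrom off (suc off ∷ γ)
      from w = record
        { sorted = Linked-≤-∷⁺ x≤γ (sorted w)
        ; ranked = rank-minimum (≤-refl ∷ x≤γ) ∷ Equivalence.from (shift-ranked x<γ) (ranked w)
        ; unit   = ≤-trans (≤-reflexive single-count) (s≤s z≤n) ∷ Equivalence.from (shift-unit x<γ) (unit w)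
        }

    peel-double : All (suc off <_) γ → WIUFRFrom off (suc off ∷ suc off ∷ γ) ⇔ WIUFRFrom (2 + off) γ
    peel-double x<γ = mk⇔ to from
      where
      x≤γ = All.map <⇒≤ x<γ
      to : WIUFRFrom off (suc off ∷ suc off ∷ γ) → WIUFRFrom (2 + off) γ
      to w = record
        { sorted = Linked.tail (Linked.tail (sorted w))
        ; ranked = Equivalence.to (shift-ranked {suc off} x<γ)
                     (Equivalence.to (shift-ranked {off} x<γ) (All.tail (All.tail (ranked w))))
        ; unit   = Equivalence.to (shift-unit x<γ) (Equivalence.to (shift-unit x<γ) (All.tail (All.tail (unit w))))
        }
      pair-count : countEq (suc off) (suc off ∷ suc off ∷ γ) ≡ 2
      pair-count = trans (countEq-∷-≡ (suc off) _)
                         (cong suc (trans (countEq-∷-≡ (suc off) γ) (cong suc (countEq-above x<γ))))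
      from : WIUFRFrom (2 + off) γ → WIUFRFrom off (suc off ∷ suc off ∷ γ)
      from w = record
        { sorted = Linked-≤-∷⁺ (≤-refl ∷ x≤γ) (Linked-≤-∷⁺ x≤γ (sorted w))
        ; ranked = rank-minimum (≤-refl ∷ ≤-refl ∷ x≤γ) ∷ rank-minimum (≤-refl ∷ ≤-refl ∷ x≤γ)
                 ∷ Equivalence.from (shift-ranked {off} x<γ)
                     (Equivalence.from (shift-ranked {suc off} x<γ) (ranked w))
        ; unit   = ≤-reflexive pair-count ∷ ≤-reflexive pair-count
                 ∷ Equivalence.from (shift-unit x<γ) (Equivalence.from (shift-unit x<γ) (unit w))
        }

  Blocks⇒WIUFRFrom : ∀ {off γ} → Blocks off γ → WIUFRFrom off γ
  Blocks⇒WIUFRFrom []         = record { sorted = [] ; ranked = [] ; unit = [] }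
  Blocks⇒WIUFRFrom (single b) = Equivalence.from (peel-single (Blocks-bound b)) (Blocks⇒WIUFRFrom b)
  Blocks⇒WIUFRFrom (double b) =
    Equivalence.from (peel-double (All.map (<-trans (n<1+n _)) (Blocks-bound b))) (Blocks⇒WIUFRFrom b)

  WIUFRFrom-head : ∀ {off x γ} → WIUFRFrom off (x ∷ γ) → x ≡ suc off
  WIUFRFrom-head w = trans (sym (All.head (ranked w))) (rank-minimum (≤-refl ∷ Linked-≤-∷⁻ (sorted w)))

  mutual
    WIUFRFrom⇒Blocks : ∀ {off} γ → WIUFRFrom off γ → Blocks off γ
    WIUFRFrom⇒Blocks []      _ = []
    WIUFRFrom⇒Blocks (x ∷ γ) w = WIUFRFrom⇒Blocks-∷ γ (WIUFRFrom-head w) w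

    WIUFRFrom⇒Blocks-∷ : ∀ {off x} γ → x ≡ suc off → WIUFRFrom off (x ∷ γ) → Blocks off (x ∷ γ)
    WIUFRFrom⇒Blocks-∷ []      refl w = single []
    WIUFRFrom⇒Blocks-∷ {off} (y ∷ γ) refl w with y ≟ suc off
    ... | no y≢x = single (WIUFRFrom⇒Blocks-∷ γ (WIUFRFrom-head w′) w′)
      where
      x<y   = ≤∧≢⇒< (Linked.head (sorted w)) (≢-sym y≢x)
      x<y∷γ = x<y ∷ All.map (<-≤-trans x<y) (Linked-≤-∷⁻ (Linked.tail (sorted w)))
      w′    = Equivalence.to (peel-single x<y∷γ) w
    ... | yes refl = double (WIUFRFrom⇒Blocks γ (Equivalence.to (peel-double x<γ) w))
      where
      pair-count = trans (countEq-∷-≡ (suc off) _) (cong suc (countEq-∷-≡ (suc off) γ))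
      no-third   = n≤0⇒n≡0 (s≤s⁻¹ (s≤s⁻¹ (subst (_≤ 2) pair-count (All.head (unit w)))))
      x<γ        = countEq≡0-above (All.tail (Linked-≤-∷⁻ (sorted w))) no-third

  any-≡ᵇ-below : ∀ {a occ} → All (_< a) occ → any (_≡ᵇ a) occ ≡ false
  any-≡ᵇ-below []            = refl
  any-≡ᵇ-below (o<a ∷ occ<a) rewrite ≡ᵇ-≢ (<⇒≢ o<a) = any-≡ᵇ-below occ<a

  firstFree-free : ∀ {n occ a fuel} → a ≤ n → All (_< a) occ → firstFree n occ a (suc fuel) ≡ (true , a)
  firstFree-free {n} {a = a} a≤n occ<a rewrite dec-false (n <? a) (≤⇒≯ a≤n) | any-≡ᵇ-below occ<a = refl

  firstFree-taken : ∀ {n occ a fuel} → a ≤ n →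
                    firstFree n (a ∷ occ) a (suc fuel) ≡ firstFree n (a ∷ occ) (suc a) fuel
  firstFree-taken {n} {a = a} a≤n rewrite dec-false (n <? a) (≤⇒≯ a≤n) | ≡ᵇ-refl a = refl

  luckyGo-lucky : ∀ {n occ a as} → firstFree n occ a n ≡ (true , a) →
                  luckyGo n occ (a ∷ as) ≡ suc (luckyGo n (a ∷ occ) as)
  luckyGo-lucky {a = a} parked rewrite parked | ≡ᵇ-refl a = refl

  luckyGo-unlucky : ∀ {n occ a as p} → firstFree n occ a n ≡ (true , p) → p ≢ a →
                    luckyGo n occ (a ∷ as) ≡ luckyGo n (p ∷ occ) as
  luckyGo-unlucky parked p≢a rewrite parked | ≡ᵇ-≢ p≢a = refl

  luckyGo-Blocks : ∀ {n off occ α} (b : Blocks off α) → length α + off ≤ n → All (_< suc off) occ →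
                   luckyGo n occ α ≡ blockCount b
  luckyGo-Blocks [] _ _ = refl
  luckyGo-Blocks {suc n} {off} (single {r} b) (s≤s h) occ< =
    trans (luckyGo-lucky (firstFree-free {fuel = n} (s≤s off≤n) occ<))
          (cong suc (luckyGo-Blocks b bound (≤-refl ∷ All.map m<n⇒m<1+n occ<)))
    where
    off≤n = m+n≤o⇒n≤o (length r) h
    bound = subst (_≤ suc n) (sym (+-suc (length r) off)) (s≤s h)
  luckyGo-Blocks {suc (suc n)} {off} {occ} (double {r} b) (s≤s (s≤s h)) occ< =
    trans (luckyGo-lucky (firstFree-free {fuel = suc n} (s≤s (≤-trans off≤n (n≤1+n n))) occ<))
          (cong suc (trans (luckyGo-unlucky second-parks 1+n≢n)
                           (luckyGo-Blocks b bound (≤-refl ∷ All.map m<n⇒m<1+n occ′<))))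
    where
    off≤n  = m+n≤o⇒n≤o (length r) h
    occ′<  = ≤-refl ∷ All.map m<n⇒m<1+n occ<
    second-parks = trans (firstFree-taken {occ = occ} {fuel = suc n} (s≤s (≤-trans off≤n (n≤1+n n))))
                         (firstFree-free {fuel = n} (s≤s (s≤s off≤n)) occ′<)
    bound  = subst (_≤ suc (suc n)) (sym (trans (+-suc (length r) (suc off)) (cong suc (+-suc (length r) off))))
                   (s≤s (s≤s h))

  -- Boolean form of "Blocks off α with k blocks". closesPairᵇ off r k says that suc off ∷ r
  -- is such a sequence starting with a pair. Both have the shape (test on the head) ∧
  -- (predicate on the tail), which is what counting over tuples needs.
  mutual
    blocksᵇ : ℕ → List ℕ → ℕ → Bool
    blocksᵇ off []      zero    = true
    blocksᵇ off []      (suc k) = false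
    blocksᵇ off (x ∷ r) zero    = false
    blocksᵇ off (x ∷ r) (suc k) = (x ≡ᵇ suc off) ∧ (blocksᵇ (suc off) r k ∨ closesPairᵇ off r k)

    closesPairᵇ : ℕ → List ℕ → ℕ → Bool
    closesPairᵇ off []      k = false
    closesPairᵇ off (y ∷ r) k = (y ≡ᵇ suc off) ∧ blocksᵇ (2 + off) r k

  mutual
    blocksᵇ-sound : ∀ off α k → T (blocksᵇ off α k) → Blocks off α
    blocksᵇ-sound off []      zero    _ = []
    blocksᵇ-sound off (x ∷ r) (suc k) t
      with head , rest ← Equivalence.to T-∧ t
      with refl ← ≡ᵇ⇒≡ x (suc off) head
      with Equivalence.to T-∨ rest
    ... | inj₁ t₁ = single (blocksᵇ-sound (suc off) r k t₁)
    ... | inj₂ t₂ = closesPairᵇ-sound off r k t₂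

    closesPairᵇ-sound : ∀ off r k → T (closesPairᵇ off r k) → Blocks off (suc off ∷ r)
    closesPairᵇ-sound off (y ∷ r) k t
      with head , rest ← Equivalence.to T-∧ t
      with refl ← ≡ᵇ⇒≡ y (suc off) head
      = double (blocksᵇ-sound (2 + off) r k rest)

  Blocks⇒closesPairᵇ≡false : ∀ {off r} k → Blocks (suc off) r → closesPairᵇ off r k ≡ false
  Blocks⇒closesPairᵇ≡false       k []         = refl
  Blocks⇒closesPairᵇ≡false {off} k (single _) rewrite ≡ᵇ-≢ (1+n≢n {off}) = refl
  Blocks⇒closesPairᵇ≡false {off} k (double _) rewrite ≡ᵇ-≢ (1+n≢n {off}) = refl

  blocksᵇ-repeat≡false : ∀ off r k → blocksᵇ (suc off) (suc off ∷ r) k ≡ false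
  blocksᵇ-repeat≡false off r zero    = refl
  blocksᵇ-repeat≡false off r (suc k) rewrite ≡ᵇ-≢ (<⇒≢ (n<1+n off)) = refl

  blocksᵇ-Blocks : ∀ {off α} (b : Blocks off α) k → blocksᵇ off α k ≡ (blockCount b ≡ᵇ k)
  blocksᵇ-Blocks []         zero    = refl
  blocksᵇ-Blocks []         (suc k) = refl
  blocksᵇ-Blocks (single b) zero    = refl
  blocksᵇ-Blocks (double b) zero    = refl
  blocksᵇ-Blocks {off} (single b) (suc k)
    rewrite ≡ᵇ-refl off | Blocks⇒closesPairᵇ≡false k b = trans (∨-identityʳ _) (blocksᵇ-Blocks b k)
  blocksᵇ-Blocks {off} (double {r} b) (suc k)
    rewrite ≡ᵇ-refl off | blocksᵇ-repeat≡false off r k = blocksᵇ-Blocks b k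

  blocksᵇ-closesPairᵇ-disjoint : ∀ off k r → blocksᵇ (suc off) r k ∧ closesPairᵇ off r k ≡ false
  blocksᵇ-closesPairᵇ-disjoint off k       []      = ∧-zeroʳ _
  blocksᵇ-closesPairᵇ-disjoint off zero    (y ∷ r) = refl
  blocksᵇ-closesPairᵇ-disjoint off (suc k) (y ∷ r) with y ≟ suc off
  ... | yes refl rewrite ≡ᵇ-≢ (<⇒≢ (n<1+n (suc off))) = refl
  ... | no y≢1+off rewrite ≡ᵇ-≢ y≢1+off = ∧-zeroʳ _

  wiufr∧lucky≡blocksᵇ : ∀ n k {α} → length α ≡ n →
                        isWIUFR α ∧ (lucky n α ≡ᵇ k) ≡ blocksᵇ 0 α k
  wiufr∧lucky≡blocksᵇ n k {α} len with isWIUFR α in wiufr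
  ... | true = sym (trans (blocksᵇ-Blocks b k)
                          (cong (_≡ᵇ k) (sym (luckyGo-Blocks b (≤-reflexive (trans (+-identityʳ _) len)) []))))
    where
    b = WIUFRFrom⇒Blocks α (Equivalence.to isWIUFR⇔WIUFRFrom (subst T (sym wiufr) _))
  ... | false with blocksᵇ 0 α k in blocks
  ...   | false = refl
  ...   | true  = contradiction (Equivalence.from isWIUFR⇔WIUFRFrom (Blocks⇒WIUFRFrom b)) (subst T wiufr)
    where
    b = blocksᵇ-sound 0 α k (subst T (sym blocks) _)

  tuples-length : ∀ m l → All (λ α → length α ≡ l) (tuples m l)
  tuples-length m zero    = refl ∷ []
  tuples-length m (suc l) =
    concat⁺ (map⁺ (All.universal (λ v → gmap⁺ {f = v ∷_} (cong suc) (tuples-length m l))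
                                 (map suc (upTo m))))

  countᵇ-tuples-suc : ∀ {m i} l (P Q : List ℕ → Bool) → i < m →
                      (∀ v r → P (v ∷ r) ≡ (v ≡ᵇ suc i) ∧ Q r) →
                      countᵇ P (tuples m (suc l)) ≡ countᵇ Q (tuples m l)
  countᵇ-tuples-suc {m} {i} l P Q i<m shape = begin
    countᵇ P (tuples m (suc l))
      ≡⟨ countᵇ-concatMap-∷ (tuples m l) shape (map suc (upTo m)) ⟩
    countᵇ (_≡ᵇ suc i) (map suc (upTo m)) * countᵇ Q (tuples m l)
      ≡⟨ cong (_* countᵇ Q (tuples m l))
              (trans (countᵇ-map (_≡ᵇ suc i) suc (upTo m)) (countᵇ-≡ᵇ-upTo i<m)) ⟩
    1 * countᵇ Q (tuples m l)
      ≡⟨ *-identityˡ _ ⟩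
    countᵇ Q (tuples m l) ∎

  compositions₁₂ : ℕ → ℕ → ℕ
  compositions₁₂ zero          zero    = 1
  compositions₁₂ zero          (suc k) = 0
  compositions₁₂ (suc n)       zero    = 0
  compositions₁₂ (suc zero)    (suc k) = compositions₁₂ zero k
  compositions₁₂ (suc (suc n)) (suc k) = compositions₁₂ (suc n) k + compositions₁₂ n k

  compositions₁₂-vanishes : ∀ {n k} → n < k → compositions₁₂ n k ≡ 0
  compositions₁₂-vanishes {zero}        {suc k} _       = refl
  compositions₁₂-vanishes {suc zero}    {suc k} (s≤s p) = compositions₁₂-vanishes p
  compositions₁₂-vanishes {suc (suc n)} {suc k} (s≤s p) =
    cong₂ _+_ (compositions₁₂-vanishes p) (compositions₁₂-vanishes (<-trans (n<1+n n) p))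

  module _ {m : ℕ} (off l : ℕ) where

    shift-bound : off + suc l ≤ m → suc off + l ≤ m
    shift-bound = subst (_≤ m) (+-suc off l)

    bound⇒< : off + suc l ≤ m → off < m
    bound⇒< h = ≤-trans (m≤m+n (suc off) l) (shift-bound h)

    countᵇ-blocksᵇ-suc : ∀ k → off < m →
      countᵇ (λ α → blocksᵇ off α (suc k)) (tuples m (suc l)) ≡
      countᵇ (λ α → blocksᵇ (suc off) α k) (tuples m l) +
      countᵇ (λ α → closesPairᵇ off α k) (tuples m l)
    countᵇ-blocksᵇ-suc k off<m =
      trans (countᵇ-tuples-suc l _ _ off<m (λ _ _ → refl))
            (countᵇ-∨ _ _ (blocksᵇ-closesPairᵇ-disjoint off k) (tuples m l))

    countᵇ-closesPairᵇ-suc : ∀ k → off < m →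
      countᵇ (λ α → closesPairᵇ off α k) (tuples m (suc l)) ≡
      countᵇ (λ α → blocksᵇ (2 + off) α k) (tuples m l)
    countᵇ-closesPairᵇ-suc k off<m = countᵇ-tuples-suc l _ _ off<m (λ _ _ → refl)

  countᵇ-blocksᵇ : ∀ {m} off l k → off + l ≤ m →
                   countᵇ (λ α → blocksᵇ off α k) (tuples m l) ≡ compositions₁₂ l k
  countᵇ-blocksᵇ off zero          zero    _ = refl
  countᵇ-blocksᵇ off zero          (suc k) _ = refl
  countᵇ-blocksᵇ off (suc l)       zero    h =
    trans (countᵇ-tuples-suc l _ (λ _ → false) (bound⇒< off l h) (λ _ _ → sym (∧-zeroʳ _)))
          (countᵇ-none (All.universal (λ _ → refl) (tuples _ l)))
  countᵇ-blocksᵇ off (suc zero)    (suc k) h =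
    trans (countᵇ-blocksᵇ-suc off zero k (bound⇒< off zero h))
          (trans (+-identityʳ _) (countᵇ-blocksᵇ (suc off) zero k (shift-bound off zero h)))
  countᵇ-blocksᵇ off (suc (suc l)) (suc k) h =
    trans (countᵇ-blocksᵇ-suc off (suc l) k (bound⇒< off (suc l) h))
          (cong₂ _+_ (countᵇ-blocksᵇ (suc off) (suc l) k h′)
                     (trans (countᵇ-closesPairᵇ-suc off l k (bound⇒< off (suc l) h))
                            (countᵇ-blocksᵇ (2 + off) l k (shift-bound (suc off) l h′))))
    where
    h′ = shift-bound off (suc l) h

  fUFR≡compositions₁₂ : ∀ n k → fUFR n k ≡ compositions₁₂ n k
  fUFR≡compositions₁₂ n k =
    trans (countᵇ-congᴬ (All.map (λ {α} → wiufr∧lucky≡blocksᵇ n k {α}) (tuples-length n n)))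
          (countᵇ-blocksᵇ 0 n k ≤-refl)

open Compositions using (compositions₁₂; compositions₁₂-vanishes; fUFR≡compositions₁₂)

module _ {c ℓ} (R : CommutativeRing c ℓ) where

  open import Data.Nat.Base using (zero) renaming (_+_ to _+ℕ_)
  open import Data.Nat.Properties using (n<1+n)
  open import Relation.Binary.PropositionalEquality as ≡ using (_≡_)
  open CommutativeRing R
  open RS (rawSR R) using (_×_; _^_)
  open import Algebra.Properties.Semiring.Mult semiring using (×-comm-*)
  open import Algebra.Properties.Monoid.Mult +-monoid using (×-homo-+)
  open import Algebra.Properties.Ring ring using (-‿distribˡ-*; -‿distribʳ-*; x[y-z]≈xy-xz)
  open import Algebra.Properties.AbelianGroup +-abelianGroup using (⁻¹-∙-comm; ⁻¹-involutive)
  open import Algebra.Solver.Ring.NaturalCoefficients.Default commutativeSemiring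
  open SetoidReasoning setoid

  module _ (q : Carrier) where

    Σ≤ : (ℕ → ℕ) → ℕ → Carrier
    Σ≤ f zero    = f 0 × q ^ 0
    Σ≤ f (suc m) = Σ≤ f m + f (suc m) × q ^ suc m

    Σ≤-suc : ∀ f m → Σ≤ f (suc m) ≈ f 0 × 1# + q * Σ≤ (λ k → f (suc k)) m
    Σ≤-suc f zero    = +-congˡ (sym (×-comm-* (f 1) q 1#))
    Σ≤-suc f (suc m) = begin
      Σ≤ f (suc m) + f (suc (suc m)) × (q * q ^ suc m)
        ≈⟨ +-cong (Σ≤-suc f m) (sym (×-comm-* (f (suc (suc m))) q _)) ⟩
      (f 0 × 1# + q * Σ≤ (λ k → f (suc k)) m) + q * (f (suc (suc m)) × q ^ suc m)
        ≈⟨ +-assoc _ _ _ ⟩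
      f 0 × 1# + (q * Σ≤ (λ k → f (suc k)) m + q * (f (suc (suc m)) × q ^ suc m))
        ≈⟨ +-congˡ (distribˡ q _ _) ⟨
      f 0 × 1# + q * Σ≤ (λ k → f (suc k)) (suc m) ∎

    Σ≤-+ : ∀ f g m → Σ≤ (λ k → f k +ℕ g k) m ≈ Σ≤ f m + Σ≤ g m
    Σ≤-+ f g zero    = ×-homo-+ _ (f 0) (g 0)
    Σ≤-+ f g (suc m) = begin
      Σ≤ (λ k → f k +ℕ g k) m + (f (suc m) +ℕ g (suc m)) × q ^ suc m
        ≈⟨ +-cong (Σ≤-+ f g m) (×-homo-+ _ (f (suc m)) (g (suc m))) ⟩
      (Σ≤ f m + Σ≤ g m) + (f (suc m) × q ^ suc m + g (suc m) × q ^ suc m)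
        ≈⟨ solve 4 (λ a b c d → (a :+ b) :+ (c :+ d) := (a :+ c) :+ (b :+ d)) refl _ _ _ _ ⟩
      Σ≤ f (suc m) + Σ≤ g (suc m) ∎

    Σ≤-extend : ∀ f m → f (suc m) ≡ 0 → Σ≤ f (suc m) ≈ Σ≤ f m
    Σ≤-extend f m f[1+m]≡0 rewrite f[1+m]≡0 = +-identityʳ _

    compositionPoly : ℕ → Carrier
    compositionPoly n = Σ≤ (compositions₁₂ n) n

    compositionPoly-0 : compositionPoly 0 ≈ 1#
    compositionPoly-0 = +-identityʳ 1#

    compositionPoly-1 : compositionPoly 1 ≈ q
    compositionPoly-1 = begin
      0# + (q * 1# + 0#) ≈⟨ +-identityˡ _ ⟩
      q * 1# + 0#        ≈⟨ +-identityʳ _ ⟩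
      q * 1#             ≈⟨ *-identityʳ q ⟩
      q                  ∎

    compositionPoly-+2 : ∀ n →
      compositionPoly (suc (suc n)) ≈ q * compositionPoly (suc n) + q * compositionPoly n
    compositionPoly-+2 n = begin
      Σ≤ (compositions₁₂ (suc (suc n))) (suc (suc n))
        ≈⟨ Σ≤-suc (compositions₁₂ (suc (suc n))) (suc n) ⟩
      0# + q * Σ≤ (λ k → compositions₁₂ (suc n) k +ℕ compositions₁₂ n k) (suc n)
        ≈⟨ +-identityˡ _ ⟩
      q * Σ≤ (λ k → compositions₁₂ (suc n) k +ℕ compositions₁₂ n k) (suc n)
        ≈⟨ *-congˡ (Σ≤-+ (compositions₁₂ (suc n)) (compositions₁₂ n) (suc n)) ⟩
      q * (compositionPoly (suc n) + Σ≤ (compositions₁₂ n) (suc n))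
        ≈⟨ distribˡ q _ _ ⟩
      q * compositionPoly (suc n) + q * Σ≤ (compositions₁₂ n) (suc n)
        ≈⟨ +-congˡ (*-congˡ (Σ≤-extend (compositions₁₂ n) n (compositions₁₂-vanishes (n<1+n n)))) ⟩
      q * compositionPoly (suc n) + q * compositionPoly n ∎

    polySum≡Σ≤-compositions₁₂ : ∀ n m → polySum R n q m ≡ Σ≤ (compositions₁₂ n) m
    polySum≡Σ≤-compositions₁₂ n zero    = ≡.cong (_× q ^ 0) (fUFR≡compositions₁₂ n 0)
    polySum≡Σ≤-compositions₁₂ n (suc m) =
      ≡.cong₂ (λ a b → a + b × q ^ suc m)
              (polySum≡Σ≤-compositions₁₂ n m) (fUFR≡compositions₁₂ n (suc m))

  module _ (p r : Carrier) {L : ℕ → Carrier}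
           (L-0 : L 0 ≈ 1#) (L-1 : L 1 ≈ p) (L-+2 : ∀ n → L (suc (suc n)) ≈ p * L (suc n) + r * L n) where

    -- L (n - 1), with L (-1) = 0
    L-pred : ℕ → Carrier
    L-pred zero    = 0#
    L-pred (suc n) = L n

    L-suc : ∀ n → L (suc n) ≈ p * L n + r * L-pred n
    L-suc zero = begin
      L 1              ≈⟨ L-1 ⟩
      p                ≈⟨ solve 2 (λ p r → p := p :* con 1 :+ r :* con 0) refl p r ⟩
      p * 1# + r * 0#  ≈⟨ +-congʳ (*-congˡ L-0) ⟨
      p * L 0 + r * 0# ∎
    L-suc (suc n) = L-+2 n

    root-^-suc : ∀ {x} → x * x ≈ p * x + r → ∀ n → x ^ suc n ≈ L n * x + r * L-pred n
    root-^-suc {x} x-root zero = begin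
      x * 1#           ≈⟨ solve 2 (λ x r → x :* con 1 := con 1 :* x :+ r :* con 0) refl x r ⟩
      1# * x + r * 0#  ≈⟨ +-congʳ (*-congʳ L-0) ⟨
      L 0 * x + r * 0# ∎
    root-^-suc {x} x-root (suc n) = begin
      x * x ^ suc n
        ≈⟨ *-congˡ (root-^-suc x-root n) ⟩
      x * (L n * x + r * L-pred n)
        ≈⟨ solve 4 (λ x a r b → x :* (a :* x :+ r :* b) := a :* (x :* x) :+ r :* b :* x)
                   refl x (L n) r (L-pred n) ⟩
      L n * (x * x) + r * L-pred n * x
        ≈⟨ +-congʳ (*-congˡ x-root) ⟩
      L n * (p * x + r) + r * L-pred n * x
        ≈⟨ solve 5 (λ x a p r b → a :* (p :* x :+ r) :+ r :* b :* x := (p :* a :+ r :* b) :* x :+ r :* a)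
                   refl x (L n) p r (L-pred n) ⟩
      (p * L n + r * L-pred n) * x + r * L n
        ≈⟨ +-congʳ (*-congʳ (L-suc n)) ⟨
      L (suc n) * x + r * L-pred (suc n) ∎

    roots-^-suc-difference : ∀ {a b} → a * a ≈ p * a + r → b * b ≈ p * b + r →
                             ∀ n → a ^ suc n - b ^ suc n ≈ (a - b) * L n
    roots-^-suc-difference {a} {b} a-root b-root n = begin
      a ^ suc n - b ^ suc n
        ≈⟨ +-cong (root-^-suc a-root n) (-‿cong (root-^-suc b-root n)) ⟩
      (L n * a + r * L-pred n) - (L n * b + r * L-pred n)
        ≈⟨ +-cancelʳ-‿ (L n * a) (L n * b) (r * L-pred n) ⟩
      L n * a - L n * b
        ≈⟨ x[y-z]≈xy-xz (L n) a b ⟨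
      L n * (a - b)
        ≈⟨ *-comm (L n) (a - b) ⟩
      (a - b) * L n ∎
      where
      +-cancelʳ-‿ : ∀ x y z → (x + z) - (y + z) ≈ x - y
      +-cancelʳ-‿ x y z = begin
        (x + z) - (y + z)
          ≈⟨ +-congˡ (⁻¹-∙-comm y z) ⟨
        (x + z) + (- y + - z)
          ≈⟨ solve 4 (λ x z y′ z′ → (x :+ z) :+ (y′ :+ z′) := (x :+ y′) :+ (z :+ z′)) refl x z (- y) (- z) ⟩
        (x - y) + (z - z)
          ≈⟨ +-congˡ (-‿inverseʳ z) ⟩
        (x - y) + 0#
          ≈⟨ +-identityʳ _ ⟩
        x - y ∎

  quadratic-root : ∀ {p r h t} → h * (1# + 1#) ≈ 1# → t * t ≈ p * p + 4 × r →
                   h * (p + t) * (h * (p + t)) ≈ p * (h * (p + t)) + r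
  quadratic-root {p} {r} {h} {t} 2h≈1 t-root = begin
    h * (p + t) * (h * (p + t))
      ≈⟨ solve 3 (λ h p t → h :* (p :+ t) :* (h :* (p :+ t))
                           := h :* h :* (p :* p :+ (con 1 :+ con 1) :* (p :* t)) :+ h :* h :* (t :* t)) refl h p t ⟩
    h * h * (p * p + (1# + 1#) * (p * t)) + h * h * (t * t)
      ≈⟨ +-congˡ (*-congˡ t-root) ⟩
    h * h * (p * p + (1# + 1#) * (p * t)) + h * h * (p * p + 4 × r)
      ≈⟨ solve 4 (λ h p t r → h :* h :* (p :* p :+ (con 1 :+ con 1) :* (p :* t))
                                :+ h :* h :* (p :* p :+ (r :+ (r :+ (r :+ (r :+ con 0)))))
                             := (h :* (con 1 :+ con 1)) :* (p :* (h :* (p :+ t)))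
                                :+ (h :* (con 1 :+ con 1)) :* (h :* (con 1 :+ con 1)) :* r) refl h p t r ⟩
    h * (1# + 1#) * (p * (h * (p + t))) + h * (1# + 1#) * (h * (1# + 1#)) * r
      ≈⟨ +-cong (*-congʳ 2h≈1) (*-congʳ (*-cong 2h≈1 2h≈1)) ⟩
    1# * (p * (h * (p + t))) + 1# * 1# * r
      ≈⟨ solve 2 (λ a r → con 1 :* a :+ con 1 :* con 1 :* r := a :+ r) refl (p * (h * (p + t))) r ⟩
    p * (h * (p + t)) + r ∎

  -x*-x≈x*x : ∀ x → - x * - x ≈ x * x
  -x*-x≈x*x x = begin
    - x * - x     ≈⟨ -‿distribˡ-* x (- x) ⟨
    - (x * - x)   ≈⟨ -‿cong (-‿distribʳ-* x x) ⟨
    - (- (x * x)) ≈⟨ ⁻¹-involutive (x * x) ⟩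
    x * x         ∎

theorem3p17 : ∀ {c ℓ} (R : CommutativeRing c ℓ) →
    let open CommutativeRing R
        open RS (rawSR R)
    in (q s h : Carrier) →
       h * (1# + 1#) ≈ 1# →
       s * s ≈ q * q + 4 × q →
       (n : ℕ) →
       (h * (q + s) - h * (q - s)) * lhsCoeff R q n
         ≈ h * (q + s) * (h * (q + s)) ^ n - h * (q - s) * (h * (q - s)) ^ n
theorem3p17 R q s h 2h≈1 s-root n = begin
  (λ₁ - λ₂) * lhsCoeff R q n
    ≈⟨ *-congˡ (reflexive (polySum≡Σ≤-compositions₁₂ R q n n)) ⟩
  (λ₁ - λ₂) * compositionPoly R q n
    ≈⟨ roots-^-suc-difference R q q (compositionPoly-0 R q) (compositionPoly-1 R q) (compositionPoly-+2 R q)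
                              λ₁-root λ₂-root n ⟨
  λ₁ ^ suc n - λ₂ ^ suc n ∎
  where
  open CommutativeRing R
  open SetoidReasoning setoid
  open RS (rawSR R) using (_^_)
  λ₁ = h * (q + s)
  λ₂ = h * (q - s)
  λ₁-root = quadratic-root R 2h≈1 s-root
  -- q - s unfolds to q + - s, so λ₂ is the root belonging to the square root - s.
  λ₂-root = quadratic-root R 2h≈1 (trans (-x*-x≈x*x R s) s-root)
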